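{- Let $f,g,s,t\geq 1$ be integers and let $n(\cdot,\cdot,\cdot,\cdot)$ be a function as described in the context. Let $n_1=n(f,2g+1,s,t)$ and $n_2=n(2g,2,s,t)$. Let $G$ be a $(K_{s,s},K_t)$-free graph, let $z_1,z_2\in V(G)$ be adjacent, and let $\mathfrak{c}=(\Lambda_{1,z},z,\Lambda_{2,z}:z\in\Lambda)$ be a $(z_1,z_2,n_1,n_2)$-crystal in $G$. Then there is a clear $(z_1,z_2,f,g)$-crystal in $G$.
   Context: Graphs are finite and simple; $G$ is $X$-free if no induced subgraph is isomorphic to $X$. Sets $X,Y$ of vertices are anticomplete if there is no edge between them. $n(q,r,s,t)$ denotes a positive integer (which exists for all integers $q,r,s,t\geq1$) with the property: for every $(K_{s,s},K_t)$-free graph $G$ and every collection $\mathcal{X}$ of at least $n(q,r,s,t)$ pairwise disjoint subsets of $V(G)$ each of cardinality at most $r$, there are $q$ distinct members of $\mathcal{X}$ that are pairwise anticomplete in $G$. For integers $f,g\geq1$ and adjacent $z_1,z_2\in V(G)$, a $(z_1,z_2,f,g)$-crystal in $G$ is a tuple $(S_{1,z},z,S_{2,z}:z\in S)$ such that: $S$ is an $f$-element subset of $V(G)\setminus\{z_1,z_2\}$; the $2f$ sets $S_{1,z},S_{2,z}$ ($z\in S$) are pairwise disjoint $g$-element subsets of $V(G)\setminus(S\cup\{z_1,z_2\})$; and for each $i\in\{1,2\}$, each $z\in S$ and each $x\in S_{i,z}$, the set of neighbors of $x$ in $\{z_1,z_2,z\}$ is exactly $\{z_i,z\}$. Such a crystal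 is clear if $S$ is a stable set and the sets $S_{1,z},S_{2,z}$ ($z\in S$) are stable sets that are pairwise anticomplete. -}

module Defs where

open import Data.Nat using (ℕ; zero; suc; _+_; _*_; _≤_)
open import Data.Fin using (Fin; zero; suc; splitAt; _≟_)
open import Data.Fin.Subset using (Subset; _∈_; ∣_∣)
open import Data.Bool using (Bool; true; false; not; _xor_)
open import Data.Sum using (_⊎_; inj₁; inj₂)
open import Data.Product using (Σ; _×_; _,_)
open import Data.Empty using (⊥; ⊥-elim)
open import Relation.Nullary using (¬_; does; yes; no)
open import Relation.Binary.PropositionalEquality using (_≡_; _≢_; refl) renaming (sym to ≡-sym)

record Graph : Set where
  field
    N      : ℕ
    adj    : Fin N → Fin N → Bool
    sym    : ∀ u v → adj u v ≡ adj v u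
    irrefl : ∀ v → adj v v ≡ false

open Graph public

Vtx : Graph → Set
Vtx G = Fin (N G)

Adj : (G : Graph) → Vtx G → Vtx G → Set
Adj G u v = adj G u v ≡ true

InducedIn : Graph → Graph → Set
InducedIn X G =
  Σ (Vtx X → Vtx G) λ φ →
    (∀ u v → φ u ≡ φ v → u ≡ v) ×
    (∀ u v → adj G (φ u) (φ v) ≡ adj X u v)

Free : Graph → Graph → Set
Free X G = ¬ InducedIn X G

isLeft : ∀ {A B : Set} → A ⊎ B → Bool
isLeft (inj₁ _) = true
isLeft (inj₂ _) = false

notNot : ∀ b → not (not b) ≡ b
notNot true  = refl
notNot false = refl

xor-comm : ∀ a b → a xor b ≡ b xor a
xor-comm true  true  = refl
xor-comm true  false = refl
xor-comm false true  = refl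
xor-comm false false = refl

xor-self : ∀ a → a xor a ≡ false
xor-self true  = refl
xor-self false = refl

K : ℕ → Graph
K t = record
  { N = t
  ; adj = λ u v → not (does (u ≟ v))
  ; sym = symK
  ; irrefl = irrK
  }
  where
  symK : ∀ (u v : Fin t) → not (does (u ≟ v)) ≡ not (does (v ≟ u))
  symK u v with u ≟ v | v ≟ u
  ... | yes _ | yes _ = refl
  ... | no _  | no _  = refl
  ... | yes p | no q  = ⊥-elim (q (≡-sym p))
  ... | no p  | yes q = ⊥-elim (p (≡-sym q))
  irrK : ∀ (v : Fin t) → not (does (v ≟ v)) ≡ false
  irrK v with v ≟ v
  ... | yes _ = refl
  ... | no p  = ⊥-elim (p refl)

Kss : ℕ → Graph
Kss s = record
  { N = s + s
  ; adj = λ u v → isLeft (splitAt s u) xor isLeft (splitAt s v)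
  ; sym = λ u v → xor-comm (isLeft (splitAt s u)) (isLeft (splitAt s v))
  ; irrefl = λ v → xor-self (isLeft (splitAt s v))
  }

KFree : ℕ → ℕ → Graph → Set
KFree s t G = Free (Kss s) G × Free (K t) G

Disjoint : ∀ {n} → Subset n → Subset n → Set
Disjoint p q = ∀ v → v ∈ p → v ∈ q → ⊥

Anticomplete : (G : Graph) → Subset (N G) → Subset (N G) → Set
Anticomplete G X Y = ∀ u v → u ∈ X → v ∈ Y → adj G u v ≡ false

-- A collection of pairwise disjoint subsets is given as an injective
-- family X : Fin m → Subset (N G) (distinct indices give distinct, disjoint
-- sets); "q distinct members" = q distinct indices.
NProperty : ℕ → ℕ → ℕ → ℕ → ℕ → Set
NProperty nv q r s t =
  (G : Graph) → KFree s t G →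
  (m : ℕ) (X : Fin m → Subset (N G)) →
  nv ≤ m →
  (∀ i → ∣ X i ∣ ≤ r) →
  (∀ i j → i ≢ j → Disjoint (X i) (X j) × X i ≢ X j) →
  Σ (Fin q → Fin m) λ h →
    (∀ i j → h i ≡ h j → i ≡ j) ×
    (∀ i j → i ≢ j → Anticomplete G (X (h i)) (X (h j)))

IsRamseyN : (ℕ → ℕ → ℕ → ℕ → ℕ) → Set
IsRamseyN n = ∀ q r s t → 1 ≤ q → 1 ≤ r → 1 ≤ s → 1 ≤ t →
  1 ≤ n q r s t × NProperty (n q r s t) q r s t

pick : ∀ {A : Set} → A → A → Fin 2 → A
pick a b zero    = a
pick a b (suc _) = b

-- A (z₁,z₂,f,g)-crystal: S is enumerated injectively by σ : Fin f → V(G),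
-- and S_{i,σ k} (i ∈ Fin 2, 0 ↦ 1, 1 ↦ 2) is enumerated by τ i k : Fin g → V(G);
-- joint injectivity of τ says the 2f sets have g elements each and are
-- pairwise disjoint.
record Crystal (G : Graph) (z₁ z₂ : Vtx G) (f g : ℕ) : Set where
  field
    σ        : Fin f → Vtx G
    σ-inj    : ∀ k l → σ k ≡ σ l → k ≡ l
    σ≢z₁     : ∀ k → σ k ≢ z₁
    σ≢z₂     : ∀ k → σ k ≢ z₂
    τ        : Fin 2 → Fin f → Fin g → Vtx G
    τ-inj    : ∀ i k a j l b → τ i k a ≡ τ j l b → (i ≡ j) × (k ≡ l) × (a ≡ b)
    τ≢σ      : ∀ i k a l → τ i k a ≢ σ l
    τ≢z₁     : ∀ i k a → τ i k a ≢ z₁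
    τ≢z₂     : ∀ i k a → τ i k a ≢ z₂
    -- neighbours of x ∈ S_{i,z} in {z₁,z₂,z} are exactly {z_i, z}
    τ-z₁     : ∀ i k a → adj G (τ i k a) z₁ ≡ pick true false i
    τ-z₂     : ∀ i k a → adj G (τ i k a) z₂ ≡ pick false true i
    τ-σ      : ∀ i k a → adj G (τ i k a) (σ k) ≡ true

-- Clear: S stable, and the sets S_{i,z} stable and pairwise anticomplete
-- (together: no edges at all among the vertices of ⋃ S_{i,z}).
Clear : ∀ {G z₁ z₂ f g} → Crystal G z₁ z₂ f g → Set
Clear {G} c =
  (∀ k l → adj G (σ k) (σ l) ≡ false) ×
  (∀ i k a j l b → adj G (τ i k a) (τ j l b) ≡ false)
  where open Crystal c

-- Two rounds of the Ramsey-type property of n. Inside each z ∈ Λ, the a-th vertices of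
-- Λ_{1,z} and Λ_{2,z} form n₂ disjoint pairs, so 2g of these pairs are pairwise
-- anticomplete; keep the side-1 vertex of g of them and the side-2 vertex of the other g.
-- Then each z with its 2g kept vertices is one of n₁ disjoint (2g+1)-sets, so f of them
-- are pairwise anticomplete. Within one z the kept vertices are anticomplete by the first
-- round, across different z by the second, and the chosen z's are stable by the second.
module Submission where

open import Defs hiding (sym)
open import Data.Nat using (ℕ; zero; suc; _+_; _*_; _≤_; z≤n; s≤s)
open import Data.Nat.Properties using (≤-refl; ≤-reflexive; ≤-trans; +-comm; +-suc; +-monoʳ-≤; m≤m+n; m≤n+m)
open import Data.Fin using (Fin; zero; suc; combine; quotient)
open import Data.Fin.Properties using (_≟_; remQuot-combine; combine-injective)
open import Data.Fin.Subset using (Subset; _∈_; ∣_∣; ⁅_⁆; _∪_; inside; outside; ⊥)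
open import Data.Fin.Subset.Properties using (x∈⁅x⁆; x∈⁅y⁆⇒x≡y; x∈p∪q⁻; x∈p∪q⁺; ∣⁅x⁆∣≡1; ∉⊥; ∣⊥∣≡0; ∣p∣≤∣x∷p∣)
open import Data.Vec using ([]; _∷_)
open import Data.Bool using (false)
open import Data.Sum using (inj₁; inj₂)
open import Data.Product using (Σ; ∃; _×_; _,_; proj₁; proj₂)
open import Data.Empty using (⊥-elim)
open import Function.Definitions using (Injective)
open import Relation.Nullary using (Dec; yes; no)
open import Relation.Binary.PropositionalEquality

∣p∪q∣≤∣p∣+∣q∣ : ∀ {n} (p q : Subset n) → ∣ p ∪ q ∣ ≤ ∣ p ∣ + ∣ q ∣
∣p∪q∣≤∣p∣+∣q∣ []            []            = z≤n
∣p∪q∣≤∣p∣+∣q∣ (inside ∷ p)  (x ∷ q)       =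
  s≤s (≤-trans (∣p∪q∣≤∣p∣+∣q∣ p q) (+-monoʳ-≤ ∣ p ∣ (∣p∣≤∣x∷p∣ x q)))
∣p∪q∣≤∣p∣+∣q∣ (outside ∷ p) (inside ∷ q)  =
  subst (suc ∣ p ∪ q ∣ ≤_) (sym (+-suc ∣ p ∣ ∣ q ∣)) (s≤s (∣p∪q∣≤∣p∣+∣q∣ p q))
∣p∪q∣≤∣p∣+∣q∣ (outside ∷ p) (outside ∷ q) = ∣p∪q∣≤∣p∣+∣q∣ p q

image : ∀ {n r} → (Fin r → Fin n) → Subset n
image {r = zero}  e = ⊥
image {r = suc r} e = ⁅ e zero ⁆ ∪ image (λ c → e (suc c))

∣image∣≤ : ∀ {n r} (e : Fin r → Fin n) → ∣ image e ∣ ≤ r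
∣image∣≤ {n} {zero} e = ≤-reflexive (∣⊥∣≡0 n)
∣image∣≤ {r = suc r} e =
  ≤-trans (∣p∪q∣≤∣p∣+∣q∣ ⁅ e zero ⁆ (image (λ c → e (suc c))))
          (subst (λ k → k + ∣ image (λ c → e (suc c)) ∣ ≤ suc r) (sym (∣⁅x⁆∣≡1 (e zero)))
                 (s≤s (∣image∣≤ (λ c → e (suc c)))))

∈-image⁺ : ∀ {n r} (e : Fin r → Fin n) c → e c ∈ image e
∈-image⁺ e zero    = x∈p∪q⁺ (inj₁ (x∈⁅x⁆ (e zero)))
∈-image⁺ e (suc c) = x∈p∪q⁺ {p = ⁅ e zero ⁆} (inj₂ (∈-image⁺ (λ c → e (suc c)) c))

∈-image⁻ : ∀ {n r} (e : Fin r → Fin n) {v} → v ∈ image e → ∃ λ c → e c ≡ v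
∈-image⁻ {r = zero}  e v∈ = ⊥-elim (∉⊥ v∈)
∈-image⁻ {r = suc r} e v∈ with x∈p∪q⁻ ⁅ e zero ⁆ (image (λ c → e (suc c))) v∈
... | inj₁ v∈⁅e0⁆ = zero , sym (x∈⁅y⁆⇒x≡y (e zero) v∈⁅e0⁆)
... | inj₂ v∈rest with ∈-image⁻ (λ c → e (suc c)) v∈rest
...   | c , ec≡v = suc c , ec≡v

BlocksDisjoint : ∀ {A B V : Set} → (A → B → V) → Set
BlocksDisjoint e = ∀ i j c d → e i c ≡ e j d → i ≡ j

record AnticompleteSubfamily (G : Graph) {m r} (q : ℕ) (e : Fin m → Fin r → Vtx G) : Set where
  field
    select              : Fin q → Fin m
    select-injective    : Injective _≡_ _≡_ select
    select-anticomplete : ∀ i j → i ≢ j → ∀ c d → adj G (e (select i) c) (e (select j) d) ≡ false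

-- Blocks are nonempty because NProperty asks distinct members to be distinct sets.
anticompleteSubfamily : ∀ {nv q r′ s t m r} → NProperty nv q r′ s t →
  (G : Graph) → KFree s t G → nv ≤ m → suc r ≤ r′ →
  (e : Fin m → Fin (suc r) → Vtx G) → BlocksDisjoint e → AnticompleteSubfamily G q e
anticompleteSubfamily P G free nv≤m r<r′ e disjoint
  with P G free _ (λ i → image (e i)) nv≤m (λ i → ≤-trans (∣image∣≤ (e i)) r<r′) distinct
  where
  distinct : ∀ i j → i ≢ j → Disjoint (image (e i)) (image (e j)) × image (e i) ≢ image (e j)
  distinct i j i≢j = disj , λ eq → disj (e i zero) (∈-image⁺ (e i) zero)
                                         (subst (e i zero ∈_) eq (∈-image⁺ (e i) zero))
    where
    disj : Disjoint (image (e i)) (image (e j))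
    disj v v∈i v∈j with ∈-image⁻ (e i) v∈i | ∈-image⁻ (e j) v∈j
    ... | c , refl | d , ejd≡v = i≢j (disjoint i j c d (sym ejd≡v))
... | h , h-inj , h-anti = record
  { select              = h
  ; select-injective    = h-inj _ _
  ; select-anticomplete = λ i j i≢j c d →
      h-anti i j i≢j _ _ (∈-image⁺ (e (h i)) c) (∈-image⁺ (e (h j)) d)
  }

subcrystal : ∀ {G z₁ z₂ f g f′ g′} (c : Crystal G z₁ z₂ f g) →
  (H : Fin f′ → Fin f) → Injective _≡_ _≡_ H →
  (h : Fin f′ → Fin 2 → Fin g′ → Fin g) → (∀ k i → Injective _≡_ _≡_ (h k i)) →
  Crystal G z₁ z₂ f′ g′
subcrystal {G} {f′ = f′} {g′ = g′} c H H-inj h h-inj = record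
  { σ     = λ k → σ (H k)
  ; σ-inj = λ k l eq → H-inj (σ-inj (H k) (H l) eq)
  ; σ≢z₁  = λ k → σ≢z₁ (H k)
  ; σ≢z₂  = λ k → σ≢z₂ (H k)
  ; τ     = τ′
  ; τ-inj = τ′-inj
  ; τ≢σ   = λ i k a l → τ≢σ i (H k) (h k i a) (H l)
  ; τ≢z₁  = λ i k a → τ≢z₁ i (H k) (h k i a)
  ; τ≢z₂  = λ i k a → τ≢z₂ i (H k) (h k i a)
  ; τ-z₁  = λ i k a → τ-z₁ i (H k) (h k i a)
  ; τ-z₂  = λ i k a → τ-z₂ i (H k) (h k i a)
  ; τ-σ   = λ i k a → τ-σ i (H k) (h k i a)
  }
  where
  open Crystal c
  τ′ : Fin 2 → Fin f′ → Fin g′ → Vtx G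
  τ′ i k a = τ i (H k) (h k i a)
  τ′-inj : ∀ i k a j l b → τ′ i k a ≡ τ′ j l b → (i ≡ j) × (k ≡ l) × (a ≡ b)
  τ′-inj i k a j l b eq with τ-inj i (H k) (h k i a) j (H l) (h l j b) eq
  ... | refl , Hk≡Hl , hka≡hlb with H-inj Hk≡Hl
  ...   | refl = refl , refl , h-inj k i hka≡hlb

module Purification
  {n : ℕ → ℕ → ℕ → ℕ → ℕ} (ramsey : IsRamseyN n)
  {f g s t : ℕ} (1≤f : 1 ≤ f) (1≤g : 1 ≤ g) (1≤s : 1 ≤ s) (1≤t : 1 ≤ t)
  (G : Graph) (free : KFree s t G) {z₁ z₂ : Vtx G}
  (c : Crystal G z₁ z₂ (n f (2 * g + 1) s t) (n (2 * g) 2 s t))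
  where

  open Crystal c
  open AnticompleteSubfamily

  n₁ n₂ : ℕ
  n₁ = n f (2 * g + 1) s t
  n₂ = n (2 * g) 2 s t

  pairs : Fin n₁ → Fin n₂ → Fin 2 → Vtx G
  pairs k a i = τ i k a

  anticompletePairs : (k : Fin n₁) → AnticompleteSubfamily G (2 * g) (pairs k)
  anticompletePairs k =
    anticompleteSubfamily {s = s} {t = t}
      (proj₂ (ramsey (2 * g) 2 s t 1≤2g (s≤s z≤n) 1≤s 1≤t))
      G free ≤-refl ≤-refl (pairs k) (λ a b i j eq → proj₂ (proj₂ (τ-inj i k a j k b eq)))
    where
    1≤2g : 1 ≤ 2 * g
    1≤2g = ≤-trans 1≤g (m≤m+n g _)

  -- Pair number combine i a contributes its vertex on side i.
  kept : Fin n₁ → Fin 2 → Fin g → Fin n₂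
  kept k i a = select (anticompletePairs k) (combine i a)

  kept-injective : ∀ k i → Injective _≡_ _≡_ (kept k i)
  kept-injective k i eq =
    proj₂ (combine-injective i _ i _ (select-injective (anticompletePairs k) eq))

  star : Fin n₁ → Fin (suc (2 * g)) → Vtx G
  star k zero    = σ k
  star k (suc x) = τ (quotient g x) k (select (anticompletePairs k) x)

  star-combine : ∀ k i a → star k (suc (combine i a)) ≡ τ i k (kept k i a)
  star-combine k i a = cong (λ j → τ j k (kept k i a)) (cong proj₁ (remQuot-combine i a))

  stars-disjoint : BlocksDisjoint star
  stars-disjoint k l zero    zero    eq = σ-inj k l eq
  stars-disjoint k l zero    (suc y) eq = ⊥-elim (τ≢σ _ l _ k (sym eq))
  stars-disjoint k l (suc x) zero    eq = ⊥-elim (τ≢σ _ k _ l eq)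
  stars-disjoint k l (suc x) (suc y) eq = proj₁ (proj₂ (τ-inj _ k _ _ l _ eq))

  anticompleteStars : AnticompleteSubfamily G f star
  anticompleteStars =
    anticompleteSubfamily {s = s} {t = t}
      (proj₂ (ramsey f (2 * g + 1) s t 1≤f (m≤n+m 1 (2 * g)) 1≤s 1≤t))
      G free ≤-refl (≤-reflexive (+-comm 1 (2 * g))) star stars-disjoint

  H : Fin f → Fin n₁
  H = select anticompleteStars

  purified : Crystal G z₁ z₂ f g
  purified = subcrystal c H (select-injective anticompleteStars)
                         (λ k → kept (H k)) (λ k → kept-injective (H k))

  kept-stable : ∀ k i a j b → adj G (τ i k (kept k i a)) (τ j k (kept k j b)) ≡ false
  kept-stable k i a j b with combine i a ≟ combine j b
  ... | no ia≢jb = select-anticomplete (anticompletePairs k) _ _ ia≢jb i j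
  ... | yes ia≡jb with combine-injective i a j b ia≡jb
  ...   | refl , refl = irrefl G _

  selected-stars-anticomplete : ∀ i k a j l b → k ≢ l →
    adj G (τ i (H k) (kept (H k) i a)) (τ j (H l) (kept (H l) j b)) ≡ false
  selected-stars-anticomplete i k a j l b k≢l =
    subst₂ (λ u v → adj G u v ≡ false) (star-combine (H k) i a) (star-combine (H l) j b)
      (select-anticomplete anticompleteStars k l k≢l (suc (combine i a)) (suc (combine j b)))

  purified-σ-stable : ∀ k l → adj G (σ (H k)) (σ (H l)) ≡ false
  purified-σ-stable k l with k ≟ l
  ... | yes refl = irrefl G _
  ... | no k≢l   = select-anticomplete anticompleteStars k l k≢l zero zero

  purified-τ-stable : ∀ i k a j l b →
    adj G (τ i (H k) (kept (H k) i a)) (τ j (H l) (kept (H l) j b)) ≡ false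
  purified-τ-stable i k a j l b = byCases (k ≟ l)
    where
    -- Matching on the decision directly: a `with k ≟ l` here makes type checking blow up.
    byCases : Dec (k ≡ l) →
      adj G (τ i (H k) (kept (H k) i a)) (τ j (H l) (kept (H l) j b)) ≡ false
    byCases (yes refl) = kept-stable (H k) i a j b
    byCases (no k≢l)   = selected-stars-anticomplete i k a j l b k≢l

  purified-clear : Clear purified
  purified-clear = purified-σ-stable , purified-τ-stable

theorem2p6 : (n : ℕ → ℕ → ℕ → ℕ → ℕ) → IsRamseyN n →
    (f g s t : ℕ) → 1 ≤ f → 1 ≤ g → 1 ≤ s → 1 ≤ t →
    (G : Graph) → KFree s t G →
    (z₁ z₂ : Vtx G) → Adj G z₁ z₂ →
    Crystal G z₁ z₂ (n f (2 * g + 1) s t) (n (2 * g) 2 s t) →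
    Σ (Crystal G z₁ z₂ f g) Clear
theorem2p6 n ramsey f g s t 1≤f 1≤g 1≤s 1≤t G free z₁ z₂ _ c = purified , purified-clear
  where open Purification ramsey 1≤f 1≤g 1≤s 1≤t G free c
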